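{- Let $t$ be a binary tree with $n$ nodes whose nodes are partitioned into micro trees $\mu_1,\dots,\mu_m$ by the Farzan–Munro algorithm with parameter $B$, and split $\mathrm{BP}_\mathrm{b}(t)$ into the left and right chunks of the micro trees as described in the context. Replace every left chunk by a single $\texttt{(}$ and every right chunk (including the empty ones) by a single $\texttt{)}$. The resulting sequence of $2m$ parentheses is the $\mathrm{BP}_\mathrm{b}$ encoding of a binary tree whose nodes correspond to the micro trees (micro tree $\mu$ corresponding to the matching pair formed by the two parentheses replacing its chunks) and in which $\mu_c$ is a child of $\mu_p$ if and only if $\mu_c$ is a child micro tree of $\mu_p$, i.e., this binary tree is the top-tier tree.
   Context: A binary tree is a rooted tree where each node has a left and a right child slot, each possibly empty. $\mathrm{BP}_\mathrm{b}(t)=\epsilon$ if $t$ is empty and otherwise $\texttt{(}\cdot \mathrm{BP}_\mathrm{b}(t_l)\cdot \texttt{)}\cdot \mathrm{BP}_\mathrm{b}(t_r)$, with $t_l,t_r$ the left and right subtrees of the root; node $v$ corresponds to the matching pair inserted when expanding the subtree rooted at $v$. The Farzan–Munro algorithm with parameter $B$ partitions the nodes of a binary tree into disjoint micro trees, each a connected set of nodes rooted at its topmost node; it is known that contracting each micro tree into a single node yields a binary tree (the top-tier tree) and that any micro tree with two child micro trees consists of a single node. A child micro tree of $\mu$ is a micro tree whose root's parent lies in $\mu$. The positions in $\mathrm{BP}_\mathrm{b}(t)$ of the parentheses of the nodes of a micro tree $\mu$ form one or two maximal intervals of consecutive positions. Chunks: if there are two such intervals, the left chunk is the left one and the right chunk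 is the right one; if there is one interval, the left chunk is that interval and the right chunk is an empty interval located immediately after it. -}

module Defs where

open import Data.Nat using (ℕ; zero; suc; _+_)
open import Data.Fin using (Fin; _≟_)
open import Data.List using (List; []; _∷_; _++_; map)
open import Data.Product using (Σ; ∃; _×_; _,_; proj₁; proj₂)
open import Data.Sum using (_⊎_)
open import Relation.Nullary using (¬_; yes; no)
open import Relation.Binary.PropositionalEquality using (_≡_)

data BTree : Set where
  leaf : BTree
  node : BTree → BTree → BTree

data Node : BTree → Set where
  here : ∀ {l r} → Node (node l r)
  inL  : ∀ {l r} → Node l → Node (node l r)
  inR  : ∀ {l r} → Node r → Node (node l r)

data ChildOf : ∀ {t} → Node t → Node t → Set where
  lchild : ∀ {l₁ l₂ r} → ChildOf {node (node l₁ l₂) r} (inL here) here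
  rchild : ∀ {l r₁ r₂} → ChildOf {node l (node r₁ r₂)} (inR here) here
  underL : ∀ {l r} {c p : Node l} → ChildOf c p → ChildOf {node l r} (inL c) (inL p)
  underR : ∀ {l r} {c p : Node r} → ChildOf c p → ChildOf {node l r} (inR c) (inR p)

-- Balanced parentheses BP_b, each parenthesis labelled by the node whose
-- matching pair it belongs to.

data Paren : Set where
  op : Paren
  cl : Paren

bpL : (t : BTree) → List (Paren × Node t)
bpL leaf = []
bpL (node l r) =
  (op , here) ∷ map (λ x → proj₁ x , inL (proj₂ x)) (bpL l)
  ++ (cl , here) ∷ map (λ x → proj₁ x , inR (proj₂ x)) (bpL r)

bp : BTree → List Paren
bp t = map proj₁ (bpL t)

-- Micro tree partitions.  A partition of the nodes of t into m micro trees
-- is a map μ : Node t → Fin m (μ x = index of the micro tree containing x).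

module _ {t : BTree} {m : ℕ} (μ : Node t → Fin m) where

  -- j is a child micro tree of k: the parent of some node of j lies in k
  -- (with j ≠ k).  (For connected micro trees that node is the root of j.)
  ChildMicro : Fin m → Fin m → Set
  ChildMicro j k = ∃ λ c → ∃ λ p → ChildOf c p × μ c ≡ j × μ p ≡ k × ¬ (j ≡ k)

  ConnectedRooted : Fin m → Set
  ConnectedRooted k =
    Σ (Node t) λ r → μ r ≡ k ×
      (∀ x → μ x ≡ k → x ≡ r ⊎ (∃ λ p → ChildOf x p × μ p ≡ k))

  Singleton : Fin m → Set
  Singleton k = ∀ x y → μ x ≡ k → μ y ≡ k → x ≡ y

  -- The properties of the Farzan–Munro partition used in the paper:
  -- nonempty micro trees, each connected and rooted at its topmost node,
  -- contraction yields a binary tree (at most two child micro trees), and a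
  -- micro tree with two (distinct) child micro trees is a single node.
  record FMPartition : Set where
    field
      nonempty  : ∀ k → ∃ λ x → μ x ≡ k
      connected : ∀ k → ConnectedRooted k
      twoChildrenSingleton :
        ∀ k j₁ j₂ → ChildMicro j₁ k → ChildMicro j₂ k → ¬ (j₁ ≡ j₂) → Singleton k
      atMostTwo :
        ∀ k j₁ j₂ j₃ → ChildMicro j₁ k → ChildMicro j₂ k → ChildMicro j₃ k →
        j₁ ≡ j₂ ⊎ j₁ ≡ j₃ ⊎ j₂ ≡ j₃

-- maximal runs: collapse consecutive equal labels (each run = one maximal
-- interval of consecutive positions belonging to one micro tree)
runsFrom : ∀ {m} → Fin m → List (Fin m) → List (Fin m)
runsFrom x [] = x ∷ []
runsFrom x (y ∷ xs) with x ≟ y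
... | yes _ = runsFrom y xs
... | no  _ = x ∷ runsFrom y xs

runs : ∀ {m} → List (Fin m) → List (Fin m)
runs [] = []
runs (x ∷ xs) = runsFrom x xs

count : ∀ {m} → Fin m → List (Fin m) → ℕ
count k [] = 0
count k (x ∷ xs) with k ≟ x
... | yes _ = suc (count k xs)
... | no  _ = count k xs

-- The first interval of micro tree k is its left chunk,
-- replaced by "(" labelled k; a second interval is its right chunk, replaced
-- by ")" labelled k; if k has only one interval, its (empty) right chunk sits
-- immediately after it and is replaced by ")" labelled k.
-- (Third or later intervals do not occur; they are dropped.)
replaceGo : ∀ {m} → List (Fin m) → List (Fin m) → List (Paren × Fin m)
replaceGo seen [] = []
replaceGo seen (k ∷ rest) with count k seen | count k rest
... | zero        | zero  = (op , k) ∷ (cl , k) ∷ replaceGo (k ∷ seen) rest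
... | zero        | suc _ = (op , k) ∷ replaceGo (k ∷ seen) rest
... | suc zero    | _     = (cl , k) ∷ replaceGo (k ∷ seen) rest
... | suc (suc _) | _     = replaceGo (k ∷ seen) rest

replaceChunks : ∀ {t m} → (Node t → Fin m) → List (Paren × Fin m)
replaceChunks {t} μ = replaceGo [] (runs (map (λ x → μ (proj₂ x)) (bpL t)))

size : BTree → ℕ
size leaf = 0
size (node l r) = suc (size l + size r)

{-# OPTIONS --safe #-}
module Submission where

-- Label every node by its micro tree and contract each micro tree to a single
-- node.  The labels of the contracted tree T, in preorder, are those of the
-- micro-tree roots, which are pairwise distinct because micro trees are
-- connected; so the labelling of T is a bijection onto the micro trees.
-- Contraction preserves the sequence of maximal runs of the labelled word
-- BP_b: inside micro tree c the runs of c alternate with the words of its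
-- child micro trees.  There are at most two of them, and two only below a
-- single node, whose word cannot end with c; a lone child goes left exactly
-- when the parentheses of c enclose it.  In T all labels differ, so the runs
-- are the two parentheses of each node, merged into one run when the node has
-- no left child, and chunk replacement turns them back into BP_b(T).  Finally
-- the edges of T are exactly the edges between distinct micro trees.

open import Defs
open import Level using (Level)
open import Data.Bool using (Bool; true; false)
open import Data.Empty using (⊥)
open import Data.Fin using (Fin; _≟_)
open import Data.List using (List; []; _∷_; _++_; _ʳ++_; map; concat; concatMap; length)
open import Data.List.Properties
  using (++-assoc; ++-identityʳ; ++-cancelʳ; ++-conicalʳ; ++-ʳ++; map-++; map-∘; concat-++)
open import Data.List.Membership.Propositional using (_∈_; _∉_)
open import Data.List.Membership.Propositional.Properties using (∈-++⁺ˡ; ∈-++⁺ʳ; ∈-++⁻)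
open import Data.List.Relation.Binary.Disjoint.Propositional using (Disjoint)
open import Data.List.Relation.Unary.All using (All; []; _∷_)
import Data.List.Relation.Unary.All.Properties as All
open import Data.List.Relation.Unary.AllPairs using ([]; _∷_)
open import Data.List.Relation.Unary.Any using (Any; here; there)
import Data.List.Relation.Unary.Any.Properties as Any
open import Data.List.Relation.Unary.Unique.Propositional using (Unique)
open import Data.List.Relation.Unary.Unique.Propositional.Properties
  using (++⁺; Unique[x∷xs]⇒x∉xs)
open import Data.Maybe using (Maybe; just; nothing)
open import Data.Maybe.Properties using (just-injective)
open import Data.Nat using (ℕ; suc)
open import Data.Product using (Σ; ∃; ∃₂; _×_; _,_; proj₁; proj₂; map₁)
open import Data.Sum using (_⊎_; inj₁; inj₂; [_,_]′)
import Data.Sum as Sum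
open import Data.Unit using (⊤; tt)
open import Function using (_∘_; id)
open import Function.Bundles using (Equivalence; _⇔_; mk⇔)
import Function.Properties.Equivalence as ⇔
open import Function.Definitions using (Bijective)
open import Relation.Nullary using (¬_; yes; no; does; contradiction)
open import Relation.Nullary.Decidable using (dec-true)
open import Relation.Binary.PropositionalEquality
  using (_≡_; _≢_; refl; sym; trans; cong; cong₂; subst; subst₂; module ≡-Reasoning)

private
  variable
    a : Level
    A : Set a
    m : ℕ

Unique-∷ : ∀ {x : A} {xs} → x ∉ xs → Unique xs → Unique (x ∷ xs)
Unique-∷ {xs = xs} x∉xs u = All.¬Any⇒All¬ xs x∉xs ∷ u

Unique-++⁻ˡ : ∀ (xs : List A) {ys} → Unique (xs ++ ys) → Unique xs
Unique-++⁻ˡ []       _        = []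
Unique-++⁻ˡ (x ∷ xs) (x≢ ∷ u) = All.++⁻ˡ xs x≢ ∷ Unique-++⁻ˡ xs u

Unique-++⁻ʳ : ∀ (xs : List A) {ys} → Unique (xs ++ ys) → Unique ys
Unique-++⁻ʳ []       u       = u
Unique-++⁻ʳ (x ∷ xs) (_ ∷ u) = Unique-++⁻ʳ xs u

Unique-++⁻-disjoint : ∀ (xs : List A) {ys} → Unique (xs ++ ys) → Disjoint xs ys
Unique-++⁻-disjoint (x ∷ xs) (x≢ ∷ _) (here refl , v∈ys)  =
  All.All¬⇒¬Any (All.++⁻ʳ xs x≢) v∈ys
Unique-++⁻-disjoint (x ∷ xs) (_ ∷ u)  (there v∈xs , v∈ys) =
  Unique-++⁻-disjoint xs u (v∈xs , v∈ys)

Unique-∷-++⁻ˡ : ∀ {x : A} xs {ys} → Unique (x ∷ xs ++ ys) → Unique (x ∷ xs)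
Unique-∷-++⁻ˡ xs (x≢ ∷ u) = All.++⁻ˡ xs x≢ ∷ Unique-++⁻ˡ xs u

Unique-∷-++⁻ʳ : ∀ {x : A} xs {ys} → Unique (x ∷ xs ++ ys) → Unique (x ∷ ys)
Unique-∷-++⁻ʳ xs (x≢ ∷ u) = All.++⁻ʳ xs x≢ ∷ Unique-++⁻ʳ xs u

∈-∉-≢ : ∀ {x y : A} {xs} → x ∈ xs → y ∉ xs → x ≢ y
∈-∉-≢ x∈xs y∉xs refl = y∉xs x∈xs

concatMap-++ : ∀ {b} {B : Set b} (f : A → List B) xs ys →
               concatMap f (xs ++ ys) ≡ concatMap f xs ++ concatMap f ys
concatMap-++ f xs ys = trans (cong concat (map-++ f xs ys)) (sym (concat-++ (map f xs) (map f ys)))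

lastOf : A → List A → A
lastOf x []       = x
lastOf x (y ∷ ys) = lastOf y ys

lastOf-∈ : ∀ (x : A) xs → lastOf x xs ∈ x ∷ xs
lastOf-∈ x []       = here refl
lastOf-∈ x (y ∷ ys) = there (lastOf-∈ y ys)

lastOf-++-∷ : ∀ (x : A) xs y ys → lastOf x (xs ++ y ∷ ys) ≡ lastOf y ys
lastOf-++-∷ x []       y ys = refl
lastOf-++-∷ x (z ∷ zs) y ys = lastOf-++-∷ z zs y ys

count-≡ : ∀ (k : Fin m) xs → count k (k ∷ xs) ≡ suc (count k xs)
count-≡ k xs with k ≟ k
... | yes _  = refl
... | no k≢k = contradiction refl k≢k

count-≢ : ∀ {k x : Fin m} xs → k ≢ x → count k (x ∷ xs) ≡ count k xs
count-≢ {k = k} {x} xs k≢x with k ≟ x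
... | yes k≡x = contradiction k≡x k≢x
... | no _    = refl

count-∉ : ∀ {k : Fin m} xs → k ∉ xs → count k xs ≡ 0
count-∉ []       _   = refl
count-∉ (x ∷ xs) k∉ = trans (count-≢ xs (k∉ ∘ here)) (count-∉ xs (k∉ ∘ there))

count-∉-++ : ∀ {k : Fin m} xs {ys} → k ∉ xs → count k (xs ++ ys) ≡ count k ys
count-∉-++ []       _   = refl
count-∉-++ (x ∷ xs) k∉ = trans (count-≢ _ (k∉ ∘ here)) (count-∉-++ xs (k∉ ∘ there))

count-ʳ++ : ∀ {k : Fin m} xs {ys} → k ∉ xs → count k (xs ʳ++ ys) ≡ count k ys
count-ʳ++ []       _   = refl
count-ʳ++ (x ∷ xs) {ys} k∉ = trans (count-ʳ++ xs (k∉ ∘ there)) (count-≢ ys (k∉ ∘ here))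

runsFrom-≡ : ∀ (x : Fin m) ys → runsFrom x (x ∷ ys) ≡ runsFrom x ys
runsFrom-≡ x ys with x ≟ x
... | yes _  = refl
... | no x≢x = contradiction refl x≢x

runsFrom-≢ : ∀ {x y : Fin m} ys → x ≢ y → runsFrom x (y ∷ ys) ≡ x ∷ runsFrom y ys
runsFrom-≢ {x = x} {y} ys x≢y with x ≟ y
... | yes x≡y = contradiction x≡y x≢y
... | no _    = refl

runsFrom-++ : ∀ (x : Fin m) xs {y} ys → lastOf x xs ≢ y →
              runsFrom x (xs ++ y ∷ ys) ≡ runsFrom x xs ++ runsFrom y ys
runsFrom-++ x []       ys last≢y = runsFrom-≢ ys last≢y
runsFrom-++ x (z ∷ zs) ys last≢y with x ≟ z
... | yes _ = runsFrom-++ z zs ys last≢y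
... | no _  = cong (x ∷_) (runsFrom-++ z zs ys last≢y)

runsFrom-++-last : ∀ (x : Fin m) xs {y} → lastOf x xs ≡ y →
                   runsFrom x (xs ++ y ∷ []) ≡ runsFrom x xs
runsFrom-++-last x []       refl = runsFrom-≡ x []
runsFrom-++-last x (z ∷ zs) last≡y with x ≟ z
... | yes _ = runsFrom-++-last z zs last≡y
... | no _  = cong (x ∷_) (runsFrom-++-last z zs last≡y)

data LTree (m : ℕ) : Set where
  lf : LTree m
  nd : Fin m → LTree m → LTree m → LTree m

word : LTree m → List (Fin m)
word lf         = []
word (nd j l r) = j ∷ (word l ++ j ∷ word r)

labels : LTree m → List (Fin m)
labels lf         = []
labels (nd j l r) = j ∷ (labels l ++ labels r)

bpLabelled : LTree m → List (Paren × Fin m)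
bpLabelled lf         = []
bpLabelled (nd j l r) = (op , j) ∷ (bpLabelled l ++ (cl , j) ∷ bpLabelled r)

-- The maximal runs of word T when T has distinct labels: the two parentheses
-- of a node without left child are adjacent and form a single run.
runWord : LTree m → List (Fin m)
runWord lf                     = []
runWord (nd j lf r)            = j ∷ runWord r
runWord (nd j l@(nd _ _ _) r) = j ∷ (runWord l ++ j ∷ runWord r)

RootLabel : LTree m → Fin m → Set
RootLabel lf         _ = ⊥
RootLabel (nd j _ _) a = j ≡ a

data Edge {m : ℕ} : LTree m → Fin m → Fin m → Set where
  left    : ∀ {b l r a} → RootLabel l a → Edge (nd b l r) a b
  right   : ∀ {b l r a} → RootLabel r a → Edge (nd b l r) a b
  inLeft  : ∀ {k l r a b} → Edge l a b → Edge (nd k l r) a b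
  inRight : ∀ {k l r a b} → Edge r a b → Edge (nd k l r) a b

CrossEdge : LTree m → Fin m → Fin m → Set
CrossEdge T a b = Edge T a b × a ≢ b

word⊆labels : ∀ (T : LTree m) {k} → k ∈ word T → k ∈ labels T
word⊆labels (nd j l r) (here k≡j) = here k≡j
word⊆labels (nd j l r) (there k∈) with ∈-++⁻ (word l) k∈
... | inj₁ k∈l         = there (∈-++⁺ˡ (word⊆labels l k∈l))
... | inj₂ (here k≡j)  = here k≡j
... | inj₂ (there k∈r) = there (∈-++⁺ʳ (labels l) (word⊆labels r k∈r))

runWord⊆labels : ∀ (T : LTree m) {k} → k ∈ runWord T → k ∈ labels T
runWord⊆labels (nd j lf r)            (here k≡j) = here k≡j
runWord⊆labels (nd j lf r)            (there k∈) = there (runWord⊆labels r k∈)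
runWord⊆labels (nd j l@(nd _ _ _) r) (here k≡j) = here k≡j
runWord⊆labels (nd j l@(nd _ _ _) r) (there k∈) =
  [ there ∘ ∈-++⁺ˡ ∘ runWord⊆labels l
  , (λ { (here k≡j)  → here k≡j
       ; (there k∈r) → there (∈-++⁺ʳ (labels l) (runWord⊆labels r k∈r)) })
  ]′ (∈-++⁻ (runWord l) k∈)

Edge-joinˡ : ∀ {j l r a b} → Edge {m} (nd j l lf) a b → Edge (nd j l r) a b
Edge-joinˡ (left a≡)  = left a≡
Edge-joinˡ (inLeft e) = inLeft e

Edge-joinʳ : ∀ {j l r a b} → Edge {m} (nd j r lf) a b → Edge (nd j l r) a b
Edge-joinʳ (left a≡)  = right a≡
Edge-joinʳ (inLeft e) = inRight e

Edge-split : ∀ {j l r a b} → Edge {m} (nd j l r) a b → Edge (nd j l lf) a b ⊎ Edge (nd j r lf) a b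
Edge-split (left a≡)   = inj₁ (left a≡)
Edge-split (right a≡)  = inj₂ (left a≡)
Edge-split (inLeft e)  = inj₁ (inLeft e)
Edge-split (inRight e) = inj₂ (inLeft e)

CrossEdge-join : ∀ {j l r a b} →
                 CrossEdge {m} (nd j l lf) a b ⊎ CrossEdge (nd j r lf) a b → CrossEdge (nd j l r) a b
CrossEdge-join = [ map₁ Edge-joinˡ , map₁ Edge-joinʳ ]′

CrossEdge-split : ∀ {j l r a b} →
                  CrossEdge {m} (nd j l r) a b → CrossEdge (nd j l lf) a b ⊎ CrossEdge (nd j r lf) a b
CrossEdge-split (e , a≢b) = Sum.map (_, a≢b) (_, a≢b) (Edge-split e)

CrossEdge-collapse : ∀ {c l r a b} → CrossEdge {m} (nd c (nd c l r) lf) a b → CrossEdge (nd c l r) a b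
CrossEdge-collapse (left refl , a≢b) = contradiction refl a≢b
CrossEdge-collapse (inLeft e  , a≢b) = e , a≢b

label : (t : BTree) → (Node t → Fin m) → LTree m
label leaf       μ = lf
label (node l r) μ = nd (μ here) (label l (μ ∘ inL)) (label r (μ ∘ inR))

shape : LTree m → BTree
shape lf         = leaf
shape (nd _ l r) = node (shape l) (shape r)

labelAt : (T : LTree m) → Node (shape T) → Fin m
labelAt (nd j l r) here    = j
labelAt (nd j l r) (inL x) = labelAt l x
labelAt (nd j l r) (inR x) = labelAt r x

label-shape : ∀ (T : LTree m) → label (shape T) (labelAt T) ≡ T
label-shape lf         = refl
label-shape (nd j l r) = cong₂ (nd j) (label-shape l) (label-shape r)

map-bpL : ∀ {B : Set} {l r} (f : Paren × Node (node l r) → B) →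
          map f (bpL (node l r)) ≡
          f (op , here) ∷ (map (λ x → f (proj₁ x , inL (proj₂ x))) (bpL l) ++
                           f (cl , here) ∷ map (λ x → f (proj₁ x , inR (proj₂ x))) (bpL r))
map-bpL {l = l} {r} f = cong (f (op , here) ∷_) (begin
    map f (map _ (bpL l) ++ (cl , here) ∷ map _ (bpL r))
  ≡⟨ map-++ f (map _ (bpL l)) _ ⟩
    map f (map _ (bpL l)) ++ f (cl , here) ∷ map f (map _ (bpL r))
  ≡⟨ cong₂ (λ xs ys → xs ++ f (cl , here) ∷ ys) (sym (map-∘ (bpL l))) (sym (map-∘ (bpL r))) ⟩
    map _ (bpL l) ++ f (cl , here) ∷ map _ (bpL r)
  ∎)
  where open ≡-Reasoning

word-label : ∀ t (μ : Node t → Fin m) → map (λ x → μ (proj₂ x)) (bpL t) ≡ word (label t μ)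
word-label leaf       μ = refl
word-label (node l r) μ =
  trans (map-bpL (λ x → μ (proj₂ x)))
        (cong (μ here ∷_) (cong₂ (λ xs ys → xs ++ μ here ∷ ys)
                                 (word-label l (μ ∘ inL)) (word-label r (μ ∘ inR))))

bpL-shape : ∀ (T : LTree m) →
            map (λ x → proj₁ x , labelAt T (proj₂ x)) (bpL (shape T)) ≡ bpLabelled T
bpL-shape lf         = refl
bpL-shape (nd j l r) =
  trans (map-bpL (λ x → proj₁ x , labelAt (nd j l r) (proj₂ x)))
        (cong ((op , j) ∷_) (cong₂ (λ xs ys → xs ++ (cl , j) ∷ ys) (bpL-shape l) (bpL-shape r)))

Edge-label⁺ : ∀ {t} (μ : Node t → Fin m) {c p} → ChildOf c p → Edge (label t μ) (μ c) (μ p)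
Edge-label⁺ μ lchild       = left refl
Edge-label⁺ μ rchild       = right refl
Edge-label⁺ μ (underL c→p) = inLeft (Edge-label⁺ (μ ∘ inL) c→p)
Edge-label⁺ μ (underR c→p) = inRight (Edge-label⁺ (μ ∘ inR) c→p)

Edge-label⁻ : ∀ t (μ : Node t → Fin m) {a b} → Edge (label t μ) a b →
              ∃₂ λ c p → ChildOf c p × μ c ≡ a × μ p ≡ b
Edge-label⁻ (node (node _ _) _) μ (left refl)  = inL here , here , lchild , refl , refl
Edge-label⁻ (node _ (node _ _)) μ (right refl) = inR here , here , rchild , refl , refl
Edge-label⁻ (node l r) μ (inLeft e) with Edge-label⁻ l (μ ∘ inL) e
... | c , p , c→p , refl , refl = inL c , inL p , underL c→p , refl , refl
Edge-label⁻ (node l r) μ (inRight e) with Edge-label⁻ r (μ ∘ inR) e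
... | c , p , c→p , refl , refl = inR c , inR p , underR c→p , refl , refl

label-∈ : ∀ {t} (μ : Node t → Fin m) x → μ x ∈ labels (label t μ)
label-∈ μ here    = here refl
label-∈ μ (inL x) = there (∈-++⁺ˡ (label-∈ (μ ∘ inL) x))
label-∈ {t = node l _} μ (inR x) =
  there (∈-++⁺ʳ (labels (label l (μ ∘ inL))) (label-∈ (μ ∘ inR) x))

labelAt-∈ : ∀ (T : LTree m) x → labelAt T x ∈ labels T
labelAt-∈ (nd j l r) here    = here refl
labelAt-∈ (nd j l r) (inL x) = there (∈-++⁺ˡ (labelAt-∈ l x))
labelAt-∈ (nd j l r) (inR x) = there (∈-++⁺ʳ (labels l) (labelAt-∈ r x))

labelAt-surjective : ∀ (T : LTree m) {k} → k ∈ labels T → ∃ λ x → labelAt T x ≡ k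
labelAt-surjective (nd j l r) (here k≡j) = here , sym k≡j
labelAt-surjective (nd j l r) (there k∈) with ∈-++⁻ (labels l) k∈
... | inj₁ k∈l = let x , e = labelAt-surjective l k∈l in inL x , e
... | inj₂ k∈r = let x , e = labelAt-surjective r k∈r in inR x , e

labelAt-injective : ∀ (T : LTree m) → Unique (labels T) →
                    ∀ {x y} → labelAt T x ≡ labelAt T y → x ≡ y
labelAt-injective (nd j l r) u@(_ ∷ u-lr) = injective
  where
  j≢l : ∀ x → j ≢ labelAt l x
  j≢l x j≡ = Unique[x∷xs]⇒x∉xs u (∈-++⁺ˡ (subst (_∈ labels l) (sym j≡) (labelAt-∈ l x)))
  j≢r : ∀ x → j ≢ labelAt r x
  j≢r x j≡ = Unique[x∷xs]⇒x∉xs u (∈-++⁺ʳ (labels l) (subst (_∈ labels r) (sym j≡) (labelAt-∈ r x)))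
  l≢r : ∀ x y → labelAt l x ≢ labelAt r y
  l≢r x y l≡r = Unique-++⁻-disjoint (labels l) u-lr
    (labelAt-∈ l x , subst (_∈ labels r) (sym l≡r) (labelAt-∈ r y))
  injective : ∀ {x y} → labelAt (nd j l r) x ≡ labelAt (nd j l r) y → x ≡ y
  injective {here}  {here}  _ = refl
  injective {here}  {inL y} e = contradiction e (j≢l y)
  injective {here}  {inR y} e = contradiction e (j≢r y)
  injective {inL x} {here}  e = contradiction (sym e) (j≢l x)
  injective {inR x} {here}  e = contradiction (sym e) (j≢r x)
  injective {inL x} {inL y} e = cong inL (labelAt-injective l (Unique-++⁻ˡ (labels l) u-lr) e)
  injective {inR x} {inR y} e = cong inR (labelAt-injective r (Unique-++⁻ʳ (labels l) u-lr) e)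
  injective {inL x} {inR y} e = contradiction e (l≢r x y)
  injective {inR x} {inL y} e = contradiction (sym e) (l≢r y x)

ChildOf⇔Edge : ∀ (T : LTree m) → Unique (labels T) →
               ∀ {u v} → ChildOf u v ⇔ Edge T (labelAt T u) (labelAt T v)
ChildOf⇔Edge T unique = mk⇔ to from
  where
  to : ∀ {u v} → ChildOf u v → Edge T (labelAt T u) (labelAt T v)
  to {u} {v} u→v =
    subst (λ T′ → Edge T′ (labelAt T u) (labelAt T v)) (label-shape T) (Edge-label⁺ (labelAt T) u→v)
  from : ∀ {u v} → Edge T (labelAt T u) (labelAt T v) → ChildOf u v
  from {u} {v} e with Edge-label⁻ (shape T) (labelAt T)
                        (subst (λ T′ → Edge T′ (labelAt T u) (labelAt T v)) (sym (label-shape T)) e)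
  ... | c , p , c→p , c≡ , p≡ =
    subst₂ ChildOf (labelAt-injective T unique c≡) (labelAt-injective T unique p≡) c→p

-- Chunk replacement on trees with distinct labels

replaceGo-single : ∀ (j : Fin m) seen rest → count j seen ≡ 0 → count j rest ≡ 0 →
                   replaceGo seen (j ∷ rest) ≡ (op , j) ∷ (cl , j) ∷ replaceGo (j ∷ seen) rest
replaceGo-single j seen rest unseen unused rewrite unseen | unused = refl

replaceGo-first : ∀ (j : Fin m) seen rest {n} → count j seen ≡ 0 → count j rest ≡ suc n →
                  replaceGo seen (j ∷ rest) ≡ (op , j) ∷ replaceGo (j ∷ seen) rest
replaceGo-first j seen rest unseen again rewrite unseen | again = refl

replaceGo-second : ∀ (j : Fin m) seen rest → count j seen ≡ 1 →
                   replaceGo seen (j ∷ rest) ≡ (cl , j) ∷ replaceGo (j ∷ seen) rest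
replaceGo-second j seen rest once rewrite once = refl

replaceGo-runWord : ∀ (T : LTree m) seen rest → Unique (labels T) →
                    (∀ {k} → k ∈ labels T → count k seen ≡ 0) →
                    (∀ {k} → k ∈ labels T → count k rest ≡ 0) →
                    replaceGo seen (runWord T ++ rest) ≡
                    bpLabelled T ++ replaceGo (runWord T ʳ++ seen) rest
replaceGo-runWord lf seen rest _ _ _ = refl
replaceGo-runWord (nd j lf r) seen rest u@(_ ∷ u-r) unseen unused =
  trans (replaceGo-single j seen _ (unseen (here refl)) j-unused)
        (cong (λ xs → (op , j) ∷ (cl , j) ∷ xs)
              (replaceGo-runWord r (j ∷ seen) rest u-r r-unseen (unused ∘ there)))
  where
  j∉r : j ∉ labels r
  j∉r = Unique[x∷xs]⇒x∉xs u
  j-unused : count j (runWord r ++ rest) ≡ 0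
  j-unused = trans (count-∉-++ (runWord r) (j∉r ∘ runWord⊆labels r)) (unused (here refl))
  r-unseen : ∀ {k} → k ∈ labels r → count k (j ∷ seen) ≡ 0
  r-unseen k∈r = trans (count-≢ seen (∈-∉-≢ k∈r j∉r)) (unseen (there k∈r))
replaceGo-runWord (nd j l@(nd _ _ _) r) seen rest u@(_ ∷ u-lr) unseen unused = begin
    replaceGo seen (j ∷ (runWord l ++ j ∷ runWord r) ++ rest)
  ≡⟨ cong (λ xs → replaceGo seen (j ∷ xs)) (++-assoc (runWord l) _ rest) ⟩
    replaceGo seen (j ∷ runWord l ++ j ∷ runWord r ++ rest)
  ≡⟨ replaceGo-first j seen _ (unseen (here refl)) j-again ⟩
    (op , j) ∷ replaceGo (j ∷ seen) (runWord l ++ j ∷ runWord r ++ rest)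
  ≡⟨ cong ((op , j) ∷_) (replaceGo-runWord l (j ∷ seen) _ u-l l-unseen l-unused) ⟩
    (op , j) ∷ (bpLabelled l ++ replaceGo seenˡ (j ∷ runWord r ++ rest))
  ≡⟨ cong (λ xs → (op , j) ∷ (bpLabelled l ++ xs)) (replaceGo-second j seenˡ _ j-once) ⟩
    (op , j) ∷ (bpLabelled l ++ (cl , j) ∷ replaceGo (j ∷ seenˡ) (runWord r ++ rest))
  ≡⟨ cong (λ xs → (op , j) ∷ (bpLabelled l ++ (cl , j) ∷ xs))
          (replaceGo-runWord r (j ∷ seenˡ) rest u-r r-unseen (unused ∘ there ∘ ∈-++⁺ʳ (labels l))) ⟩
    (op , j) ∷ (bpLabelled l ++ (cl , j) ∷ bpLabelled r ++ replaceGo (runWord r ʳ++ j ∷ seenˡ) rest)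
  ≡⟨ cong ((op , j) ∷_) (++-assoc (bpLabelled l) _ _) ⟨
    bpLabelled (nd j l r) ++ replaceGo (runWord r ʳ++ j ∷ seenˡ) rest
  ≡⟨ cong (λ s → bpLabelled (nd j l r) ++ replaceGo s rest) (++-ʳ++ (runWord l)) ⟨
    bpLabelled (nd j l r) ++ replaceGo (runWord (nd j l r) ʳ++ seen) rest
  ∎
  where
  open ≡-Reasoning
  seenˡ = runWord l ʳ++ j ∷ seen
  u-l = Unique-++⁻ˡ (labels l) u-lr
  u-r = Unique-++⁻ʳ (labels l) u-lr
  l∩r = Unique-++⁻-disjoint (labels l) u-lr
  j∉l : j ∉ labels l
  j∉l = Unique[x∷xs]⇒x∉xs u ∘ ∈-++⁺ˡ
  j∉r : j ∉ labels r
  j∉r = Unique[x∷xs]⇒x∉xs u ∘ ∈-++⁺ʳ (labels l)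
  j-again : count j (runWord l ++ j ∷ runWord r ++ rest) ≡ suc (count j (runWord r ++ rest))
  j-again = trans (count-∉-++ (runWord l) (j∉l ∘ runWord⊆labels l)) (count-≡ j _)
  j-once : count j seenˡ ≡ 1
  j-once = trans (count-ʳ++ (runWord l) (j∉l ∘ runWord⊆labels l))
                 (trans (count-≡ j seen) (cong suc (unseen (here refl))))
  l-unseen : ∀ {k} → k ∈ labels l → count k (j ∷ seen) ≡ 0
  l-unseen k∈l = trans (count-≢ seen (∈-∉-≢ k∈l j∉l)) (unseen (there (∈-++⁺ˡ k∈l)))
  l-unused : ∀ {k} → k ∈ labels l → count k (j ∷ runWord r ++ rest) ≡ 0
  l-unused k∈l = trans (count-≢ _ (∈-∉-≢ k∈l j∉l))
    (trans (count-∉-++ (runWord r) (λ k∈ → l∩r (k∈l , runWord⊆labels r k∈)))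
           (unused (there (∈-++⁺ˡ k∈l))))
  r-unseen : ∀ {k} → k ∈ labels r → count k (j ∷ seenˡ) ≡ 0
  r-unseen k∈r = trans (count-≢ seenˡ (∈-∉-≢ k∈r j∉r))
    (trans (count-ʳ++ (runWord l) (λ k∈ → l∩r (runWord⊆labels l k∈ , k∈r)))
           (trans (count-≢ seen (∈-∉-≢ k∈r j∉r)) (unseen (there (∈-++⁺ʳ (labels l) k∈r)))))

replaceGo-runWord-[] : ∀ (T : LTree m) → Unique (labels T) → replaceGo [] (runWord T) ≡ bpLabelled T
replaceGo-runWord-[] T unique = begin
    replaceGo [] (runWord T)        ≡⟨ cong (replaceGo []) (++-identityʳ (runWord T)) ⟨
    replaceGo [] (runWord T ++ [])  ≡⟨ replaceGo-runWord T [] [] unique (λ _ → refl) (λ _ → refl) ⟩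
    bpLabelled T ++ []              ≡⟨ ++-identityʳ (bpLabelled T) ⟩
    bpLabelled T                    ∎
  where open ≡-Reasoning

fresh : Maybe (Fin m) → Fin m → List (Fin m)
fresh nothing  j = j ∷ []
fresh (just c) j with c ≟ j
... | yes _ = []
... | no  _ = j ∷ []

-- The labels of the nodes whose parent carries another label, in preorder;
-- p is the label of the parent of the root.
entries : Maybe (Fin m) → LTree m → List (Fin m)
entries p lf         = []
entries p (nd j l r) = fresh p j ++ (entries (just j) l ++ entries (just j) r)

∈-fresh : ∀ (p : Maybe (Fin m)) j → p ≡ just j ⊎ j ∈ fresh p j
∈-fresh nothing  j = inj₂ (here refl)
∈-fresh (just c) j with c ≟ j
... | yes refl = inj₁ refl
... | no  _    = inj₂ (here refl)

∈-fresh⁻ : ∀ (p : Maybe (Fin m)) j {a} → a ∈ fresh p j → a ≡ j × p ≢ just j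
∈-fresh⁻ nothing  j (here refl) = refl , λ ()
∈-fresh⁻ (just c) j a∈ with c ≟ j
∈-fresh⁻ (just c) j (here refl) | no c≢j = refl , c≢j ∘ just-injective

Unique-fresh : ∀ (p : Maybe (Fin m)) j → Unique (fresh p j)
Unique-fresh nothing  j = [] ∷ []
Unique-fresh (just c) j with c ≟ j
... | yes _ = []
... | no  _ = [] ∷ []

labels⊆entries : ∀ p (T : LTree m) {a} → a ∈ labels T → p ≡ just a ⊎ a ∈ entries p T
labels⊆entries p (nd j l r) (here refl) = Sum.map₂ ∈-++⁺ˡ (∈-fresh p j)
labels⊆entries p (nd j l r) (there a∈) with ∈-++⁻ (labels l) a∈
... | inj₁ a∈l with labels⊆entries (just j) l a∈l
...   | inj₁ refl = labels⊆entries p (nd j l r) (here refl)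
...   | inj₂ a∈e  = inj₂ (∈-++⁺ʳ (fresh p j) (∈-++⁺ˡ a∈e))
labels⊆entries p (nd j l r) (there a∈) | inj₂ a∈r with labels⊆entries (just j) r a∈r
...   | inj₁ refl = labels⊆entries p (nd j l r) (here refl)
...   | inj₂ a∈e  = inj₂ (∈-++⁺ʳ (fresh p j) (∈-++⁺ʳ (entries (just j) l) a∈e))

labels⊆entries-root : ∀ (T : LTree m) {a} → a ∈ labels T → a ∈ entries nothing T
labels⊆entries-root T a∈ = [ (λ ()) , id ]′ (labels⊆entries nothing T a∈)

Unique-∷-entries⇒∉-labels : ∀ {c} (T : LTree m) → Unique (c ∷ entries nothing T) → c ∉ labels T
Unique-∷-entries⇒∉-labels T u = Unique[x∷xs]⇒x∉xs u ∘ labels⊆entries-root T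

-- Contraction of the label classes

endsWith : Fin m → LTree m → Bool
endsWith c s = does (lastOf c (word s) ≟ c)

nodeWith : Fin m → LTree m × LTree m → LTree m
nodeWith j lr = nd j (proj₁ lr) (proj₂ lr)

-- A lone child micro tree goes left iff the word of its parent's subtree ends
-- with a parenthesis of the parent, i.e. the child lies between its two chunks.
placeChildren : List (LTree m) → Bool → LTree m × LTree m
placeChildren []          _     = lf , lf
placeChildren (T ∷ [])    true  = T , lf
placeChildren (T ∷ [])    false = lf , T
placeChildren (T ∷ U ∷ _) _     = T , U

mutual
  contractNode : Fin m → LTree m → LTree m → LTree m
  contractNode j l r = nodeWith j (childrenOf j l r)

  childrenOf : Fin m → LTree m → LTree m → LTree m × LTree m
  childrenOf j l r = placeChildren (hang j l ++ hang j r) (endsWith j r)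

  -- The contracted child micro trees of c whose roots lie in s, when the
  -- parent of the root of s belongs to c.
  hang : Fin m → LTree m → List (LTree m)
  hang c lf = []
  hang c (nd j l r) with c ≟ j
  ... | yes _ = hang c l ++ hang c r
  ... | no  _ = contractNode j l r ∷ []

contract : LTree m → LTree m
contract lf         = lf
contract (nd j l r) = contractNode j l r

data IsNode {m : ℕ} : LTree m → Set where
  isNode : ∀ {j l r} → IsNode (nd j l r)

hang-IsNode : ∀ (c : Fin m) s → All IsNode (hang c s)
hang-IsNode c lf = []
hang-IsNode c (nd j l r) with c ≟ j
... | yes _ = All.++⁺ (hang-IsNode c l) (hang-IsNode c r)
... | no  _ = isNode ∷ []

children-IsNode : ∀ (j : Fin m) l r → All IsNode (hang j l ++ hang j r)
children-IsNode j l r = All.++⁺ (hang-IsNode j l) (hang-IsNode j r)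

hang-[]⇒endsWith : ∀ (c : Fin m) s → hang c s ≡ [] → lastOf c (word s) ≡ c
hang-[]⇒endsWith c lf _ = refl
hang-[]⇒endsWith c (nd j l r) none with c ≟ j
... | yes refl = trans (lastOf-++-∷ c (word l) c (word r))
                       (hang-[]⇒endsWith c r (++-conicalʳ (hang c l) (hang c r) none))
hang-[]⇒endsWith c (nd j l r) () | no _

endsWith-true⁻ : ∀ (c : Fin m) s → endsWith c s ≡ true → lastOf c (word s) ≡ c
endsWith-true⁻ c s ends with lastOf c (word s) ≟ c
... | yes last≡c = last≡c
endsWith-true⁻ c s () | no _

lastOf-word-∈ : ∀ j (l r : LTree m) → lastOf j (word l ++ j ∷ word r) ∈ labels (nd j l r)
lastOf-word-∈ j l r = word⊆labels (nd j l r) (lastOf-∈ j (word l ++ j ∷ word r))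

two-children⇒inner-edge : ∀ j (l r : LTree m) → Unique (j ∷ entries (just j) r) →
                          length (hang j l ++ hang j r) ≡ 2 → lastOf j (word r) ≡ j →
                          Edge (nd j l r) j j
two-children⇒inner-edge j lf         lf         _ () _
two-children⇒inner-edge j (nd x a b) lf         _ _  _ with j ≟ x
... | yes refl = left refl
two-children⇒inner-edge j (nd x a b) lf         _ () _ | no _
two-children⇒inner-edge j l          (nd x a b) u _  ends with j ≟ x
... | yes refl = right refl
... | no _     = contradiction (subst (_∈ labels (nd x a b)) ends (lastOf-word-∈ x a b))
                               (Unique-∷-entries⇒∉-labels (nd x a b) u)

roots : List (LTree m) → List (Fin m)
roots []              = []
roots (lf ∷ Ts)       = roots Ts
roots (nd a _ _ ∷ Ts) = a ∷ roots Ts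

roots-++ : ∀ (Ts Us : List (LTree m)) → roots (Ts ++ Us) ≡ roots Ts ++ roots Us
roots-++ []              Us = refl
roots-++ (lf ∷ Ts)       Us = roots-++ Ts Us
roots-++ (nd a _ _ ∷ Ts) Us = cong (a ∷_) (roots-++ Ts Us)

forestLabels : List (LTree m) → List (Fin m)
forestLabels = concatMap labels

roots⊆forestLabels : ∀ (Ts : List (LTree m)) {a} → a ∈ roots Ts → a ∈ forestLabels Ts
roots⊆forestLabels (lf ∷ Ts)       a∈          = roots⊆forestLabels Ts a∈
roots⊆forestLabels (nd a _ _ ∷ Ts) (here refl) = here refl
roots⊆forestLabels (nd _ l r ∷ Ts) (there a∈)  =
  there (∈-++⁺ʳ (labels l ++ labels r) (roots⊆forestLabels Ts a∈))

Unique-roots : ∀ (Ts : List (LTree m)) → Unique (forestLabels Ts) → Unique (roots Ts)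
Unique-roots []              _ = []
Unique-roots (lf ∷ Ts)       u = Unique-roots Ts u
Unique-roots (nd a l r ∷ Ts) u@(_ ∷ u-rest) =
  Unique-∷ (Unique[x∷xs]⇒x∉xs u ∘ ∈-++⁺ʳ (labels l ++ labels r) ∘ roots⊆forestLabels Ts)
           (Unique-roots Ts (Unique-++⁻ʳ (labels l ++ labels r) u-rest))

childRuns : Fin m → List (LTree m) → List (Fin m)
childRuns c = concatMap (λ T → c ∷ runWord T)

trailing : Fin m → Bool → List (Fin m)
trailing c true  = c ∷ []
trailing c false = []

ValidChildren : List (LTree m) → Bool → Set
ValidChildren []              b = b ≡ true
ValidChildren (_ ∷ [])        _ = ⊤
ValidChildren (_ ∷ _ ∷ [])    b = b ≡ false
ValidChildren (_ ∷ _ ∷ _ ∷ _) _ = ⊥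

runWord-placeChildren : ∀ j (Ts : List (LTree m)) b → All IsNode Ts → ValidChildren Ts b →
                        runWord (nodeWith j (placeChildren Ts b)) ≡ childRuns j Ts ++ trailing j b
runWord-placeChildren j []                  .true []            refl = refl
runWord-placeChildren j (T@(nd _ _ _) ∷ []) true  (isNode ∷ []) _    =
  cong (λ xs → j ∷ (xs ++ j ∷ [])) (sym (++-identityʳ (runWord T)))
runWord-placeChildren j (T@(nd _ _ _) ∷ []) false (isNode ∷ []) _    =
  cong (j ∷_) (sym (trans (++-identityʳ _) (++-identityʳ (runWord T))))
runWord-placeChildren j (T@(nd _ _ _) ∷ U ∷ []) .false (isNode ∷ _ ∷ []) refl =
  sym (trans (++-identityʳ _) (cong (λ xs → j ∷ (runWord T ++ j ∷ xs)) (++-identityʳ (runWord U))))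

labels-placeChildren : ∀ j (Ts : List (LTree m)) b → ValidChildren Ts b →
                       labels (nodeWith j (placeChildren Ts b)) ≡ j ∷ forestLabels Ts
labels-placeChildren j []           .true  refl = refl
labels-placeChildren j (T ∷ [])     true   _    = refl
labels-placeChildren j (T ∷ [])     false  _    = cong (j ∷_) (sym (++-identityʳ (labels T)))
labels-placeChildren j (T ∷ U ∷ []) .false refl =
  cong (λ xs → j ∷ (labels T ++ xs)) (sym (++-identityʳ (labels U)))

ForestEdge : Fin m → List (LTree m) → Fin m → Fin m → Set
ForestEdge j Ts a b = (b ≡ j × a ∈ roots Ts) ⊎ Any (λ T → Edge T a b) Ts

ForestEdge-++⁻ : ∀ {j a b} (Ts Us : List (LTree m)) →
                 ForestEdge j (Ts ++ Us) a b → ForestEdge j Ts a b ⊎ ForestEdge j Us a b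
ForestEdge-++⁻ Ts Us (inj₁ (b≡j , a∈)) rewrite roots-++ Ts Us =
  Sum.map (λ a∈Ts → inj₁ (b≡j , a∈Ts)) (λ a∈Us → inj₁ (b≡j , a∈Us)) (∈-++⁻ (roots Ts) a∈)
ForestEdge-++⁻ Ts Us (inj₂ e) = Sum.map inj₂ inj₂ (Any.++⁻ Ts e)

ForestEdge-++⁺ : ∀ {j a b} (Ts Us : List (LTree m)) →
                 ForestEdge j Ts a b ⊎ ForestEdge j Us a b → ForestEdge j (Ts ++ Us) a b
ForestEdge-++⁺ Ts Us (inj₁ (inj₁ (b≡j , a∈))) rewrite roots-++ Ts Us = inj₁ (b≡j , ∈-++⁺ˡ a∈)
ForestEdge-++⁺ Ts Us (inj₂ (inj₁ (b≡j , a∈))) rewrite roots-++ Ts Us =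
  inj₁ (b≡j , ∈-++⁺ʳ (roots Ts) a∈)
ForestEdge-++⁺ Ts Us (inj₁ (inj₂ e)) = inj₂ (Any.++⁺ˡ e)
ForestEdge-++⁺ Ts Us (inj₂ (inj₂ e)) = inj₂ (Any.++⁺ʳ Ts e)

ForestEdge-placeChildren : ∀ {j a b} (Ts : List (LTree m)) t →
                           Edge (nodeWith j (placeChildren Ts t)) a b → ForestEdge j Ts a b
ForestEdge-placeChildren (nd _ _ _ ∷ [])           true  (left refl)  = inj₁ (refl , here refl)
ForestEdge-placeChildren (nd _ _ _ ∷ [])           false (right refl) = inj₁ (refl , here refl)
ForestEdge-placeChildren (T ∷ [])                  true  (inLeft e)   = inj₂ (here e)
ForestEdge-placeChildren (T ∷ [])                  false (inRight e)  = inj₂ (here e)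
ForestEdge-placeChildren (nd _ _ _ ∷ U ∷ _)        _     (left refl)  = inj₁ (refl , here refl)
ForestEdge-placeChildren (lf ∷ nd _ _ _ ∷ _)       _     (right refl) = inj₁ (refl , here refl)
ForestEdge-placeChildren (nd _ _ _ ∷ nd _ _ _ ∷ _) _     (right refl) =
  inj₁ (refl , there (here refl))
ForestEdge-placeChildren (T ∷ U ∷ _)               _     (inLeft e)   = inj₂ (here e)
ForestEdge-placeChildren (T ∷ U ∷ _)               _     (inRight e)  = inj₂ (there (here e))

Edge-placeChildren : ∀ {j a b} (Ts : List (LTree m)) t → All IsNode Ts → ValidChildren Ts t →
                     ForestEdge j Ts a b → Edge (nodeWith j (placeChildren Ts t)) a b
Edge-placeChildren []           _     _ _ (inj₁ (_ , ()))
Edge-placeChildren []           _     _ _ (inj₂ ())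
Edge-placeChildren (_ ∷ [])     true  (isNode ∷ []) _ (inj₁ (refl , here refl)) = left refl
Edge-placeChildren (_ ∷ [])     false (isNode ∷ []) _ (inj₁ (refl , here refl)) = right refl
Edge-placeChildren (_ ∷ [])     true  _ _ (inj₂ (here e)) = inLeft e
Edge-placeChildren (_ ∷ [])     false _ _ (inj₂ (here e)) = inRight e
Edge-placeChildren (_ ∷ _ ∷ []) _ (isNode ∷ isNode ∷ []) _ (inj₁ (refl , here refl))         = left refl
Edge-placeChildren (_ ∷ _ ∷ []) _ (isNode ∷ isNode ∷ []) _ (inj₁ (refl , there (here refl))) = right refl
Edge-placeChildren (_ ∷ _ ∷ []) _ _ _ (inj₂ (here e))         = inLeft e
Edge-placeChildren (_ ∷ _ ∷ []) _ _ _ (inj₂ (there (here e))) = inRight e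

mutual
  CrossEdge-contractNode : ∀ j (l r : LTree m) {a b} →
                           Edge (contractNode j l r) a b → CrossEdge (nd j l r) a b
  CrossEdge-contractNode j l r =
    CrossEdge-join ∘ Sum.map (CrossEdge-hang j l) (CrossEdge-hang j r) ∘
    ForestEdge-++⁻ (hang j l) (hang j r) ∘
    ForestEdge-placeChildren (hang j l ++ hang j r) (endsWith j r)

  CrossEdge-hang : ∀ c (s : LTree m) {a b} → ForestEdge c (hang c s) a b → CrossEdge (nd c s lf) a b
  CrossEdge-hang c lf (inj₁ (_ , ()))
  CrossEdge-hang c lf (inj₂ ())
  CrossEdge-hang c (nd j l r) fe with c ≟ j
  ... | yes refl = map₁ inLeft (CrossEdge-join (Sum.map (CrossEdge-hang c l) (CrossEdge-hang c r)
                                                        (ForestEdge-++⁻ (hang c l) (hang c r) fe)))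
  CrossEdge-hang c (nd j l r) (inj₁ (refl , here refl)) | no c≢j = left refl , c≢j ∘ sym
  CrossEdge-hang c (nd j l r) (inj₂ (here e))           | no _   =
    map₁ inLeft (CrossEdge-contractNode j l r e)

AtMostTwoChildren : LTree m → Set
AtMostTwoChildren S = ∀ {k j₁ j₂ j₃} → CrossEdge S j₁ k → CrossEdge S j₂ k → CrossEdge S j₃ k →
                      j₁ ≡ j₂ ⊎ j₁ ≡ j₃ ⊎ j₂ ≡ j₃

BranchingHasNoInnerEdge : LTree m → Set
BranchingHasNoInnerEdge S =
  ∀ {k j₁ j₂} → CrossEdge S j₁ k → CrossEdge S j₂ k → j₁ ≢ j₂ → ¬ Edge S k k

record FMLabelled (S : LTree m) : Set where
  field
    atMostTwoChildren       : AtMostTwoChildren S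
    branchingHasNoInnerEdge : BranchingHasNoInnerEdge S
    uniqueEntries           : Unique (entries nothing S)

module Contraction {m} (S : LTree m) (fm : FMLabelled S) where

  open FMLabelled fm

  Embedded : LTree m → Set
  Embedded T = ∀ {a b} → Edge T a b → Edge S a b

  -- The invariants of the recursion: at the root of micro tree j, and at a
  -- subtree whose root's parent lies in micro tree c.
  Rooted : Fin m → LTree m → LTree m → Set
  Rooted j l r = Unique (entries nothing (nd j l r)) × Embedded (nd j l r)

  Hanging : Fin m → LTree m → Set
  Hanging c s = Unique (c ∷ entries (just c) s) × Embedded (nd c s lf)

  Rooted⇒Hangingˡ : ∀ {j l r} → Rooted j l r → Hanging j l
  Rooted⇒Hangingˡ {l = l} (u , emb) = Unique-∷-++⁻ˡ (entries _ l) u , emb ∘ Edge-joinˡ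

  Rooted⇒Hangingʳ : ∀ {j l r} → Rooted j l r → Hanging j r
  Rooted⇒Hangingʳ {l = l} (u , emb) = Unique-∷-++⁻ʳ (entries _ l) u , emb ∘ Edge-joinʳ

  -- Hanging c (nd j l r) unfolded in the two cases of c ≟ j.
  Hanging-same⇒Rooted : ∀ {c l r} → Unique (c ∷ entries (just c) l ++ entries (just c) r) ×
                        Embedded (nd c (nd c l r) lf) → Rooted c l r
  Hanging-same⇒Rooted (u , emb) = u , emb ∘ inLeft

  Hanging-other⇒Rooted : ∀ {c j l r} → Unique (c ∷ entries nothing (nd j l r)) ×
                         Embedded (nd c (nd j l r) lf) → Rooted j l r
  Hanging-other⇒Rooted ((_ ∷ u) , emb) = u , emb ∘ inLeft

  validChildren : ∀ j (Ts : List (LTree m)) b → All IsNode Ts → Unique (roots Ts) →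
                  (∀ {a} → a ∈ roots Ts → CrossEdge S a j) →
                  (Ts ≡ [] → b ≡ true) → (length Ts ≡ 2 → b ≡ true → Edge S j j) →
                  ValidChildren Ts b
  validChildren j [] b _ _ _ none _ = none refl
  validChildren j (_ ∷ []) b _ _ _ _ _ = tt
  validChildren j (_ ∷ _ ∷ []) true (isNode ∷ isNode ∷ []) ((a≢c ∷ []) ∷ _) cross _ two =
    contradiction (two refl refl)
                  (branchingHasNoInnerEdge (cross (here refl)) (cross (there (here refl))) a≢c)
  validChildren j (_ ∷ _ ∷ []) false _ _ _ _ _ = refl
  validChildren j (_ ∷ _ ∷ _ ∷ _) b (isNode ∷ isNode ∷ isNode ∷ _)
                ((a≢b ∷ a≢c ∷ _) ∷ (b≢c ∷ _) ∷ _) cross _ _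
    with atMostTwoChildren (cross (here refl)) (cross (there (here refl)))
                           (cross (there (there (here refl))))
  ... | inj₁ a≡b        = a≢b a≡b
  ... | inj₂ (inj₁ a≡c) = a≢c a≡c
  ... | inj₂ (inj₂ b≡c) = b≢c b≡c

  children-cross : ∀ j l r → Rooted j l r →
                   ∀ {a} → a ∈ roots (hang j l ++ hang j r) → CrossEdge S a j
  children-cross j l r (_ , emb) a∈ rewrite roots-++ (hang j l) (hang j r) =
    map₁ emb (CrossEdge-join (Sum.map (λ a∈l → CrossEdge-hang j l (inj₁ (refl , a∈l)))
                                      (λ a∈r → CrossEdge-hang j r (inj₁ (refl , a∈r)))
                                      (∈-++⁻ (roots (hang j l)) a∈)))

  mutual
    children-valid : ∀ j l r → Rooted j l r → ValidChildren (hang j l ++ hang j r) (endsWith j r)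
    children-valid j l r ρ@(_ ∷ u , emb) =
      validChildren j (hang j l ++ hang j r) (endsWith j r) (children-IsNode j l r)
        (Unique-roots (hang j l ++ hang j r) (subst Unique (sym (forestLabels-children j l r ρ)) u))
        (children-cross j l r ρ)
        (λ none → dec-true (lastOf j (word r) ≟ j)
                           (hang-[]⇒endsWith j r (++-conicalʳ (hang j l) _ none)))
        (λ two ends → emb (two-children⇒inner-edge j l r (proj₁ (Rooted⇒Hangingʳ ρ)) two
                                                   (endsWith-true⁻ j r ends)))

    forestLabels-children : ∀ j l r → Rooted j l r →
                            forestLabels (hang j l ++ hang j r) ≡ entries (just j) l ++ entries (just j) r
    forestLabels-children j l r ρ =
      trans (concatMap-++ labels (hang j l) (hang j r))
            (cong₂ _++_ (forestLabels-hang j l (Rooted⇒Hangingˡ ρ))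
                        (forestLabels-hang j r (Rooted⇒Hangingʳ ρ)))

    forestLabels-hang : ∀ c s → Hanging c s → forestLabels (hang c s) ≡ entries (just c) s
    forestLabels-hang c lf         _ = refl
    forestLabels-hang c (nd j l r) η with c ≟ j
    ... | yes refl = forestLabels-children c l r (Hanging-same⇒Rooted η)
    ... | no  _    = trans (++-identityʳ _) (labels-contractNode j l r (Hanging-other⇒Rooted η))

    labels-contractNode : ∀ j l r → Rooted j l r → labels (contractNode j l r) ≡ entries nothing (nd j l r)
    labels-contractNode j l r ρ =
      trans (labels-placeChildren j _ _ (children-valid j l r ρ))
            (cong (j ∷_) (forestLabels-children j l r ρ))

  mutual
    runs-contractNode : ∀ j l r → Rooted j l r →
                        runsFrom j (word l ++ j ∷ word r) ≡ runWord (contractNode j l r)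
    runs-contractNode j l r ρ = begin
        runsFrom j (word l ++ j ∷ word r)
      ≡⟨ runsFrom-hang j l (Rooted⇒Hangingˡ ρ) (word r) ⟩
        childRuns j (hang j l) ++ runsFrom j (word r)
      ≡⟨ cong (childRuns j (hang j l) ++_) (runsFrom-word-hang j r (Rooted⇒Hangingʳ ρ)) ⟩
        childRuns j (hang j l) ++ childRuns j (hang j r) ++ trailing j (endsWith j r)
      ≡⟨ ++-assoc (childRuns j (hang j l)) _ _ ⟨
        (childRuns j (hang j l) ++ childRuns j (hang j r)) ++ trailing j (endsWith j r)
      ≡⟨ cong (_++ trailing j (endsWith j r)) (concatMap-++ _ (hang j l) (hang j r)) ⟨
        childRuns j (hang j l ++ hang j r) ++ trailing j (endsWith j r)
      ≡⟨ runWord-placeChildren j _ _ (children-IsNode j l r) (children-valid j l r ρ) ⟨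
        runWord (contractNode j l r)
      ∎
      where open ≡-Reasoning

    runsFrom-hang : ∀ c s → Hanging c s → ∀ ys →
                    runsFrom c (word s ++ c ∷ ys) ≡ childRuns c (hang c s) ++ runsFrom c ys
    runsFrom-hang c lf _ ys = runsFrom-≡ c ys
    runsFrom-hang c (nd j l r) η ys with c ≟ j
    ... | yes refl = begin
        runsFrom c ((word l ++ c ∷ word r) ++ c ∷ ys)
      ≡⟨ cong (runsFrom c) (++-assoc (word l) _ _) ⟩
        runsFrom c (word l ++ c ∷ word r ++ c ∷ ys)
      ≡⟨ runsFrom-hang c l (Rooted⇒Hangingˡ ρ) _ ⟩
        childRuns c (hang c l) ++ runsFrom c (word r ++ c ∷ ys)
      ≡⟨ cong (childRuns c (hang c l) ++_) (runsFrom-hang c r (Rooted⇒Hangingʳ ρ) ys) ⟩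
        childRuns c (hang c l) ++ childRuns c (hang c r) ++ runsFrom c ys
      ≡⟨ ++-assoc (childRuns c (hang c l)) _ _ ⟨
        (childRuns c (hang c l) ++ childRuns c (hang c r)) ++ runsFrom c ys
      ≡⟨ cong (_++ runsFrom c ys) (concatMap-++ _ (hang c l) (hang c r)) ⟨
        childRuns c (hang c l ++ hang c r) ++ runsFrom c ys
      ∎
      where
      open ≡-Reasoning
      ρ = Hanging-same⇒Rooted η
    ... | no _ = cong (c ∷_) (begin
        runsFrom j ((word l ++ j ∷ word r) ++ c ∷ ys)
      ≡⟨ runsFrom-++ j (word l ++ j ∷ word r) ys last≢c ⟩
        runsFrom j (word l ++ j ∷ word r) ++ runsFrom c ys
      ≡⟨ cong (_++ runsFrom c ys) (runs-contractNode j l r (Hanging-other⇒Rooted η)) ⟩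
        runWord (contractNode j l r) ++ runsFrom c ys
      ≡⟨ cong (_++ runsFrom c ys) (++-identityʳ _) ⟨
        (runWord (contractNode j l r) ++ []) ++ runsFrom c ys
      ∎)
      where
      open ≡-Reasoning
      last≢c : lastOf j (word l ++ j ∷ word r) ≢ c
      last≢c last≡c = Unique-∷-entries⇒∉-labels (nd j l r) (proj₁ η)
                        (subst (_∈ labels (nd j l r)) last≡c (lastOf-word-∈ j l r))

    runsFrom-word-hang : ∀ c s → Hanging c s →
                         runsFrom c (word s) ≡ childRuns c (hang c s) ++ trailing c (endsWith c s)
    runsFrom-word-hang c s η with lastOf c (word s) ≟ c
    ... | yes last≡c = trans (sym (runsFrom-++-last c (word s) last≡c)) (runsFrom-hang c s η [])
    ... | no  last≢c = sym (trans (++-identityʳ _) (++-cancelʳ (c ∷ []) _ _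
                          (trans (sym (runsFrom-hang c s η [])) (runsFrom-++ c (word s) [] last≢c))))

  mutual
    Edge-contractNode : ∀ j l r → Rooted j l r →
                        ∀ {a b} → CrossEdge (nd j l r) a b → Edge (contractNode j l r) a b
    Edge-contractNode j l r ρ =
      Edge-placeChildren (hang j l ++ hang j r) (endsWith j r) (children-IsNode j l r)
                         (children-valid j l r ρ) ∘
      ForestEdge-++⁺ (hang j l) (hang j r) ∘
      Sum.map (ForestEdge-hang j l (Rooted⇒Hangingˡ ρ)) (ForestEdge-hang j r (Rooted⇒Hangingʳ ρ)) ∘
      CrossEdge-split

    ForestEdge-hang : ∀ c s → Hanging c s →
                      ∀ {a b} → CrossEdge (nd c s lf) a b → ForestEdge c (hang c s) a b
    ForestEdge-hang c lf _ (left () , _)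
    ForestEdge-hang c lf _ (inLeft () , _)
    ForestEdge-hang c (nd j l r) η ce with c ≟ j
    ... | yes refl =
      ForestEdge-++⁺ (hang c l) (hang c r)
        (Sum.map (ForestEdge-hang c l (Rooted⇒Hangingˡ ρ)) (ForestEdge-hang c r (Rooted⇒Hangingʳ ρ))
                 (CrossEdge-split (CrossEdge-collapse ce)))
      where ρ = Hanging-same⇒Rooted η
    ForestEdge-hang c (nd j l r) η (left refl , _)   | no _ = inj₁ (refl , here refl)
    ForestEdge-hang c (nd j l r) η (inLeft e , a≢b) | no _ =
      inj₂ (here (Edge-contractNode j l r (Hanging-other⇒Rooted η) (e , a≢b)))

runs-word-contract : ∀ (S : LTree m) → FMLabelled S → runs (word S) ≡ runWord (contract S)
runs-word-contract lf         _  = refl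
runs-word-contract (nd j l r) fm = runs-contractNode j l r (FMLabelled.uniqueEntries fm , id)
  where open Contraction (nd j l r) fm

labels-contract : ∀ (S : LTree m) → FMLabelled S → labels (contract S) ≡ entries nothing S
labels-contract lf         _  = refl
labels-contract (nd j l r) fm = labels-contractNode j l r (FMLabelled.uniqueEntries fm , id)
  where open Contraction (nd j l r) fm

Edge-contract : ∀ (S : LTree m) → FMLabelled S → ∀ {a b} → Edge (contract S) a b ⇔ CrossEdge S a b
Edge-contract lf         _  = mk⇔ (λ ()) (λ { (() , _) })
Edge-contract (nd j l r) fm =
  mk⇔ (CrossEdge-contractNode j l r) (Edge-contractNode j l r (FMLabelled.uniqueEntries fm , id))
  where open Contraction (nd j l r) fm

Unique-labels-contract : ∀ (S : LTree m) → FMLabelled S → Unique (labels (contract S))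
Unique-labels-contract S fm = subst Unique (sym (labels-contract S fm)) (FMLabelled.uniqueEntries fm)

labels⊆labels-contract : ∀ (S : LTree m) → FMLabelled S →
                         ∀ {a} → a ∈ labels S → a ∈ labels (contract S)
labels⊆labels-contract S fm a∈ = subst (_ ∈_) (sym (labels-contract S fm)) (labels⊆entries-root S a∈)

bpLabelled-contract : ∀ (S : LTree m) → FMLabelled S →
                      bpLabelled (contract S) ≡ replaceGo [] (runs (word S))
bpLabelled-contract S fm = begin
    bpLabelled (contract S)
  ≡⟨ replaceGo-runWord-[] (contract S) (Unique-labels-contract S fm) ⟨
    replaceGo [] (runWord (contract S))
  ≡⟨ cong (replaceGo []) (runs-word-contract S fm) ⟨
    replaceGo [] (runs (word S))
  ∎
  where open ≡-Reasoning

-- Micro-tree labellings of binary trees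

parentLabel : ∀ {t} → Maybe (Fin m) → (Node t → Fin m) → Node t → Maybe (Fin m)
parentLabel p μ here    = p
parentLabel p μ (inL x) = parentLabel (just (μ here)) (μ ∘ inL) x
parentLabel p μ (inR x) = parentLabel (just (μ here)) (μ ∘ inR) x

IsEntry : ∀ {t} → Maybe (Fin m) → (Node t → Fin m) → Node t → Set
IsEntry p μ x = parentLabel p μ x ≢ just (μ x)

parentLabel-ChildOf : ∀ {t} p (μ : Node t → Fin m) {x y} → ChildOf x y → parentLabel p μ x ≡ just (μ y)
parentLabel-ChildOf p μ lchild      = refl
parentLabel-ChildOf p μ rchild      = refl
parentLabel-ChildOf p μ (underL ch) = parentLabel-ChildOf _ (μ ∘ inL) ch
parentLabel-ChildOf p μ (underR ch) = parentLabel-ChildOf _ (μ ∘ inR) ch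

∈-entries-label : ∀ p t (μ : Node t → Fin m) {a} → a ∈ entries p (label t μ) →
                  ∃ λ x → IsEntry p μ x × μ x ≡ a
∈-entries-label p (node l r) μ a∈ with ∈-++⁻ (fresh p (μ here)) a∈
... | inj₁ a∈root = let a≡ , p≢ = ∈-fresh⁻ p _ a∈root in here , p≢ , sym a≡
... | inj₂ a∈lr with ∈-++⁻ (entries _ (label l (μ ∘ inL))) a∈lr
...   | inj₁ a∈l = let x , ex , e = ∈-entries-label _ l (μ ∘ inL) a∈l in inL x , ex , e
...   | inj₂ a∈r = let x , ex , e = ∈-entries-label _ r (μ ∘ inR) a∈r in inR x , ex , e

inL-injective : ∀ {l r} {x y : Node l} → inL {r = r} x ≡ inL y → x ≡ y
inL-injective refl = refl

inR-injective : ∀ {l r} {x y : Node r} → inR {l = l} x ≡ inR y → x ≡ y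
inR-injective refl = refl

Unique-entries-label : ∀ p t (μ : Node t → Fin m) →
                       (∀ {x y} → IsEntry p μ x → IsEntry p μ y → μ x ≡ μ y → x ≡ y) →
                       Unique (entries p (label t μ))
Unique-entries-label p leaf       μ _   = []
Unique-entries-label p (node l r) μ inj =
  ++⁺ (Unique-fresh p (μ here))
      (++⁺ (Unique-entries-label _ l (μ ∘ inL) (λ ex ey → inL-injective ∘ inj ex ey))
           (Unique-entries-label _ r (μ ∘ inR) (λ ex ey → inR-injective ∘ inj ex ey))
           left∩right)
      root∩children
  where
  left∩right : Disjoint (entries _ (label l (μ ∘ inL))) (entries _ (label r (μ ∘ inR)))
  left∩right (a∈l , a∈r) with ∈-entries-label _ l (μ ∘ inL) a∈l | ∈-entries-label _ r (μ ∘ inR) a∈r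
  ... | x , ex , refl | y , ey , e with inj {inL x} {inR y} ex ey (sym e)
  ... | ()
  root∩children : Disjoint (fresh p (μ here))
                           (entries _ (label l (μ ∘ inL)) ++ entries _ (label r (μ ∘ inR)))
  root∩children (a∈root , a∈lr) with ∈-fresh⁻ p _ a∈root | ∈-++⁻ (entries _ (label l (μ ∘ inL))) a∈lr
  ... | refl , p≢ | inj₁ a∈l with ∈-entries-label _ l (μ ∘ inL) a∈l
  ...   | x , ex , e with inj {here} {inL x} p≢ ex (sym e)
  ...     | ()
  root∩children (a∈root , a∈lr) | refl , p≢ | inj₂ a∈r with ∈-entries-label _ r (μ ∘ inR) a∈r
  ...   | x , ex , e with inj {here} {inR x} p≢ ex (sym e)
  ...     | ()

ChildOf-irrefl : ∀ {t} {x : Node t} → ¬ ChildOf x x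
ChildOf-irrefl (underL ch) = ChildOf-irrefl ch
ChildOf-irrefl (underR ch) = ChildOf-irrefl ch

module _ {t} (μ : Node t → Fin m) where

  ChildMicro⇔CrossEdge : ∀ {a b} → ChildMicro μ a b ⇔ CrossEdge (label t μ) a b
  ChildMicro⇔CrossEdge = mk⇔
    (λ { (c , p , c→p , refl , refl , a≢b) → Edge-label⁺ μ c→p , a≢b })
    (λ { (e , a≢b) → let c , p , c→p , c≡ , p≡ = Edge-label⁻ t μ e in c , p , c→p , c≡ , p≡ , a≢b })

  module _ (fm : FMPartition μ) where
    open FMPartition fm

    private
      childMicro : ∀ {a b} → CrossEdge (label t μ) a b → ChildMicro μ a b
      childMicro = Equivalence.from ChildMicro⇔CrossEdge

    label-FMLabelled : FMLabelled (label t μ)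
    label-FMLabelled = record
      { atMostTwoChildren       = λ e₁ e₂ e₃ →
          atMostTwo _ _ _ _ (childMicro e₁) (childMicro e₂) (childMicro e₃)
      ; branchingHasNoInnerEdge = branching
      ; uniqueEntries           = Unique-entries-label nothing t μ entry-injective
      }
      where
      branching : BranchingHasNoInnerEdge (label t μ)
      branching e₁ e₂ j₁≢j₂ e with Edge-label⁻ t μ e
      ... | c , p , c→p , c≡ , p≡ = ChildOf-irrefl (subst (λ x → ChildOf x p)
        (twoChildrenSingleton _ _ _ (childMicro e₁) (childMicro e₂) j₁≢j₂ c p c≡ p≡) c→p)
      entry-injective : ∀ {x y} → IsEntry nothing μ x → IsEntry nothing μ y → μ x ≡ μ y → x ≡ y
      entry-injective {x} {y} ex ey μx≡μy with connected (μ x)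
      ... | r , _ , rooted with rooted x refl | rooted y (sym μx≡μy)
      ... | inj₁ x≡r | inj₁ y≡r = trans x≡r (sym y≡r)
      ... | inj₂ (q , x→q , μq≡) | _ =
        contradiction (trans (parentLabel-ChildOf nothing μ x→q) (cong just μq≡)) ex
      ... | _ | inj₂ (q , y→q , μq≡) =
        contradiction (trans (parentLabel-ChildOf nothing μ y→q) (cong just (trans μq≡ μx≡μy))) ey

theorem13 : (t : BTree) (n : ℕ) → size t ≡ n → (m : ℕ) (μ : Node t → Fin m) →
    FMPartition μ →
    Σ BTree λ T → Σ (Node T → Fin m) λ φ →
      Bijective _≡_ _≡_ φ ×
      map (λ x → proj₁ x , φ (proj₂ x)) (bpL T) ≡ replaceChunks μ ×
      (∀ u v → ChildOf u v ⇔ ChildMicro μ (φ u) (φ v))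
theorem13 t _ _ m μ fm =
  shape T , labelAt T , (labelAt-injective T unique-T , surjective) , bpL-T , λ u v → edges
  where
  S = label t μ
  fmS = label-FMLabelled μ fm
  T = contract S
  unique-T = Unique-labels-contract S fmS

  surjective : ∀ k → ∃ λ x → ∀ {z} → z ≡ x → labelAt T z ≡ k
  surjective k with FMPartition.nonempty fm k
  ... | y , refl with labelAt-surjective T (labels⊆labels-contract S fmS (label-∈ μ y))
  ... | x , labelAt≡ = x , λ { refl → labelAt≡ }

  bpL-T : map (λ x → proj₁ x , labelAt T (proj₂ x)) (bpL (shape T)) ≡ replaceChunks μ
  bpL-T = trans (bpL-shape T)
                (trans (bpLabelled-contract S fmS) (cong (replaceGo [] ∘ runs) (sym (word-label t μ))))

  edges : ∀ {u v} → ChildOf u v ⇔ ChildMicro μ (labelAt T u) (labelAt T v)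
  edges = ⇔.trans (ChildOf⇔Edge T unique-T)
                  (⇔.trans (Edge-contract S fmS) (⇔.sym (ChildMicro⇔CrossEdge μ)))
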